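{- Let $A,B$ be an instance of $2$-Max-Duo and let $G=(V,E)$ be the graph constructed from it as described in the context. Suppose two consecutive vertices $v_{i,j}$ and $v_{i+1,j+1}$ of $V$ belong to two different squares $S(i_1,i_1';j_1,j_1')$ and $S(i_2,i_2';j_2,j_2')$ respectively. Then $\{i_2,i_2'\}=\{i_1+1,i_1'+1\}$ and $\{j_2,j_2'\}=\{j_1+1,j_1'+1\}$. That is, the second square is $S(i_1+1,i_1'+1;j_1+1,j_1'+1)$, and the two squares are consecutive.
   Context: $A=(a_1,\dots,a_n)$ and $B=(b_1,\dots,b_n)$ are strings such that $B$ is a permutation of $A$ and every letter occurs at most twice in each of $A$ and $B$. $H=(A,B,F)$ is the bipartite graph with vertex classes $a_1,\dots,a_n$ and $b_1,\dots,b_n$, and an edge $e_{i,j}$ between $a_i$ and $b_j$ if and only if the letters $a_i$ and $b_j$ are equal. $G=(V,E)$ has vertex set $V=\{v_{i,j}: 1\le i,j\le n-1,\ e_{i,j},e_{i+1,j+1}\in F\}$. Two distinct vertices are adjacent if and only if their corresponding pairs of edges $(e_{i,j},e_{i+1,j+1})$ cannot both be contained in a common perfect matching of $H$. The vertices $v_{i,j}$ and $v_{i+1,j+1}$ are called consecutive. For $i\ne i'$ and $j\ne j'$ with $v_{i,j},v_{i,j'},v_{i',j},v_{i',j'}\in V$, the subgraph induced on these four vertices is the square $S(i,i';j,j')$. As a vertex set it does not depend on the order of $i,i'$ or of $j,j'$. The squares $S(i,i';j,j')$ and $S(i+1,i'+1;j+1,j'+1)$ are called consecutive. -}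

module Defs where

open import Data.Nat using (ℕ; suc; _<_; _≤_; _≟_)
open import Data.Fin using (Fin; toℕ; fromℕ<)
open import Data.Vec using (Vec; lookup; toList; count)
open import Data.List.Relation.Binary.Permutation.Propositional using (_↭_)
open import Data.Product using (Σ; _×_; _,_; ∃)
open import Data.Sum using (_⊎_)
open import Relation.Binary.PropositionalEquality using (_≡_)
open import Relation.Nullary using (¬_)
open import Function.Definitions using (Bijective)

-- Conventions: letters are natural numbers; strings of length n are Vec ℕ n;
-- positions are 0-based natural numbers (paper index k corresponds to k - 1).

record TwoMaxDuo {n : ℕ} (A B : Vec ℕ n) : Set where
  field
    perm     : toList B ↭ toList A
    atMost2A : ∀ (x : ℕ) → count (_≟ x) A ≤ 2
    atMost2B : ∀ (x : ℕ) → count (_≟ x) B ≤ 2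

Edge : {n : ℕ} → Vec ℕ n → Vec ℕ n → ℕ → ℕ → Set
Edge {n} A B i j =
  Σ (i < n) λ p → Σ (j < n) λ q → lookup A (fromℕ< p) ≡ lookup B (fromℕ< q)

Vertex : {n : ℕ} → Vec ℕ n → Vec ℕ n → ℕ → ℕ → Set
Vertex A B i j = Edge A B i j × Edge A B (suc i) (suc j)

record PerfectMatching {n : ℕ} (A B : Vec ℕ n) : Set where
  field
    π      : Fin n → Fin n
    bij    : Bijective _≡_ _≡_ π
    onEdge : ∀ k → lookup A k ≡ lookup B (π k)

ContainsEdge : {n : ℕ} {A B : Vec ℕ n} → PerfectMatching A B → ℕ → ℕ → Set
ContainsEdge {n} M i j =
  Σ (i < n) λ p → toℕ (PerfectMatching.π M (fromℕ< p)) ≡ j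

Adjacent : {n : ℕ} → Vec ℕ n → Vec ℕ n → ℕ → ℕ → ℕ → ℕ → Set
Adjacent A B i j i' j' =
  Vertex A B i j × Vertex A B i' j' × ¬ (i ≡ i' × j ≡ j') ×
  ¬ (Σ (PerfectMatching A B) λ M →
       ContainsEdge M i j × ContainsEdge M (suc i) (suc j) ×
       ContainsEdge M i' j' × ContainsEdge M (suc i') (suc j'))

IsSquare : {n : ℕ} → Vec ℕ n → Vec ℕ n → ℕ → ℕ → ℕ → ℕ → Set
IsSquare A B i i' j j' =
  ¬ (i ≡ i') × ¬ (j ≡ j') ×
  Vertex A B i j × Vertex A B i j' × Vertex A B i' j × Vertex A B i' j'

InSquare : ℕ → ℕ → ℕ → ℕ → ℕ → ℕ → Set
InSquare k l i i' j j' = (k ≡ i ⊎ k ≡ i') × (l ≡ j ⊎ l ≡ j')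

SamePair : ℕ → ℕ → ℕ → ℕ → Set
SamePair a b c d = (a ≡ c × b ≡ d) ⊎ (a ≡ d × b ≡ c)

SameSquare : ℕ → ℕ → ℕ → ℕ → ℕ → ℕ → ℕ → ℕ → Set
SameSquare i₁ i₁' j₁ j₁' i₂ i₂' j₂ j₂' =
  SamePair i₁ i₁' i₂ i₂' × SamePair j₁ j₁' j₂ j₂'

module Submission where

-- All edges of H join equal letters, so in a square S(i,i';j,j') the
-- four "lower" edges e_{i,j}, e_{i,j'}, e_{i',j}, e_{i',j'} carry one common letter,
-- and so do the four "upper" edges e_{i+1,j+1}, …, e_{i'+1,j'+1}.  Let y be the
-- letter at position i+1 of A.  Since i ∈ {i₁,i₁'}, y is the letter of the upper
-- edges of the first square; since i+1 ∈ {i₂,i₂'}, y is also the letter of the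
-- lower edges of the second square.  Hence y occurs in A at the positions
-- i₁+1 ≠ i₁'+1 and at i₂ ≠ i₂', and in B at j₁+1 ≠ j₁'+1 and at j₂ ≠ j₂'.  As y
-- occurs at most twice in A and in B, both pairs of positions coincide.

open import Defs
open import Data.Nat using (ℕ; suc; _≤_; _<_; _≟_; _≡ᵇ_; z≤n; s≤s)
open import Data.Nat.Properties using (≡⇒≡ᵇ; ≤-trans; suc-injective)
open import Data.Fin using (Fin; zero; suc; toℕ; fromℕ<; punchOut)
open import Data.Fin.Properties using (toℕ-fromℕ<; punchOut-injective)
open import Data.Vec using (Vec; _∷_; lookup; count; removeAt)
open import Data.Vec.Properties using (removeAt-punchOut)
open import Data.Product using (Σ; _×_; _,_)
open import Data.Sum as Sum using (_⊎_; inj₁; inj₂)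
open import Data.Bool using (true; false)
open import Function using (_∘_)
open import Relation.Nullary using (¬_; yes; no; contradiction)
open import Relation.Binary.PropositionalEquality using (_≡_; _≢_; refl; sym; trans; cong)

count-removeAt : ∀ {n x} (V : Vec ℕ (suc n)) (p : Fin (suc n)) → lookup V p ≡ x →
                 count (_≟ x) V ≡ suc (count (_≟ x) (removeAt V p))
count-removeAt {x = x} (y ∷ V) zero y≡x with y ≡ᵇ x | ≡⇒≡ᵇ y x y≡x
... | true | _ = refl
count-removeAt {x = x} (y ∷ z ∷ V) (suc p) zp≡x with y ≡ᵇ x
... | true  = cong suc (count-removeAt (z ∷ V) p zp≡x)
... | false = count-removeAt (z ∷ V) p zp≡x

lookup-removeAt : ∀ {n x} (V : Vec ℕ (suc n)) {p q : Fin (suc n)} (p≢q : p ≢ q) →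
                  lookup V q ≡ x → lookup (removeAt V p) (punchOut p≢q) ≡ x
lookup-removeAt V p≢q Vq≡x = trans (removeAt-punchOut V p≢q) Vq≡x

one-occurrence : ∀ {n x} (V : Vec ℕ n) {p : Fin n} → lookup V p ≡ x → 1 ≤ count (_≟ x) V
one-occurrence {suc n} V {p} Vp≡x rewrite count-removeAt V p Vp≡x = s≤s z≤n

two-occurrences : ∀ {n x} (V : Vec ℕ n) {p q : Fin n} → p ≢ q →
                  lookup V p ≡ x → lookup V q ≡ x → 2 ≤ count (_≟ x) V
two-occurrences {suc n} V {p} p≢q Vp≡x Vq≡x rewrite count-removeAt V p Vp≡x
  = s≤s (one-occurrence (removeAt V p) (lookup-removeAt V p≢q Vq≡x))

three-occurrences : ∀ {n x} (V : Vec ℕ n) {p q r : Fin n} →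
                    p ≢ q → p ≢ r → q ≢ r →
                    lookup V p ≡ x → lookup V q ≡ x → lookup V r ≡ x →
                    3 ≤ count (_≟ x) V
three-occurrences {suc n} V {p} p≢q p≢r q≢r Vp≡x Vq≡x Vr≡x
  rewrite count-removeAt V p Vp≡x
  = s≤s (two-occurrences (removeAt V p)
           (q≢r ∘ punchOut-injective p≢q p≢r)
           (lookup-removeAt V p≢q Vq≡x) (lookup-removeAt V p≢r Vr≡x))

OccursAt : {n : ℕ} → Vec ℕ n → ℕ → ℕ → Set
OccursAt {n} V k x = Σ (k < n) λ k<n → lookup V (fromℕ< k<n) ≡ x

fromℕ<-≢ : ∀ {n k l} (k<n : k < n) (l<n : l < n) → k ≢ l → fromℕ< k<n ≢ fromℕ< l<n
fromℕ<-≢ k<n l<n k≢l eq =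
  k≢l (trans (sym (toℕ-fromℕ< k<n)) (trans (cong toℕ eq) (toℕ-fromℕ< l<n)))

only-two-positions : ∀ {n x a b c} (V : Vec ℕ n) → count (_≟ x) V ≤ 2 → a ≢ b →
                     OccursAt V a x → OccursAt V b x → OccursAt V c x → c ≡ a ⊎ c ≡ b
only-two-positions {x = x} {a} {b} {c} V atMost2 a≢b (a< , Va) (b< , Vb) (c< , Vc)
  with c ≟ a | c ≟ b
... | yes c≡a | _       = inj₁ c≡a
... | no _    | yes c≡b = inj₂ c≡b
... | no c≢a  | no c≢b  = contradiction (≤-trans three≤count atMost2) λ { (s≤s (s≤s ())) }
  where
  three≤count : 3 ≤ count (_≟ x) V
  three≤count = three-occurrences V (fromℕ<-≢ a< b< a≢b) (fromℕ<-≢ a< c< (c≢a ∘ sym))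
                  (fromℕ<-≢ b< c< (c≢b ∘ sym)) Va Vb Vc

same-positions : ∀ {n x a b c d} (V : Vec ℕ n) → count (_≟ x) V ≤ 2 → a ≢ b → c ≢ d →
                 OccursAt V a x → OccursAt V b x → OccursAt V c x → OccursAt V d x →
                 SamePair c d a b
same-positions V atMost2 a≢b c≢d Va Vb Vc Vd
  with only-two-positions V atMost2 a≢b Va Vb Vc | only-two-positions V atMost2 a≢b Va Vb Vd
... | inj₁ c≡a | inj₂ d≡b = inj₁ (c≡a , d≡b)
... | inj₂ c≡b | inj₁ d≡a = inj₂ (c≡b , d≡a)
... | inj₁ c≡a | inj₁ d≡a = contradiction (trans c≡a (sym d≡a)) c≢d
... | inj₂ c≡b | inj₂ d≡b = contradiction (trans c≡b (sym d≡b)) c≢d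

module _ {n : ℕ} (A B : Vec ℕ n) where

  along-edge : ∀ {i j x} → Edge A B i j → OccursAt A i x → OccursAt B j x
  along-edge (_ , j< , Ai≡Bj) (_ , Ai≡x) = j< , trans (sym Ai≡Bj) Ai≡x

  against-edge : ∀ {i j x} → Edge A B i j → OccursAt B j x → OccursAt A i x
  against-edge (i< , _ , Ai≡Bj) (_ , Bj≡x) = i< , trans Ai≡Bj Bj≡x

  Corners : ℕ → ℕ → ℕ → ℕ → ℕ → Set
  Corners x i i' j j' = OccursAt A i x × OccursAt A i' x × OccursAt B j x × OccursAt B j' x

  edge-square : ∀ {i i' j j' k x} → Edge A B i j → Edge A B i j' → Edge A B i' j →
                k ≡ i ⊎ k ≡ i' → OccursAt A k x → Corners x i i' j j'
  edge-square eij eij' ei'j (inj₁ refl) Ai =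
    Ai , against-edge ei'j (along-edge eij Ai) , along-edge eij Ai , along-edge eij' Ai
  edge-square eij eij' ei'j (inj₂ refl) Ai' =
    against-edge eij Bj , Ai' , Bj , along-edge eij' (against-edge eij Bj)
    where
    Bj : OccursAt B _ _
    Bj = along-edge ei'j Ai'

  lower-corners : ∀ {i i' j j' k x} → IsSquare A B i i' j j' →
                  k ≡ i ⊎ k ≡ i' → OccursAt A k x → Corners x i i' j j'
  lower-corners (_ , _ , (eij , _) , (eij' , _) , (ei'j , _) , _) =
    edge-square eij eij' ei'j

  upper-corners : ∀ {i i' j j' k x} → IsSquare A B i i' j j' →
                  k ≡ i ⊎ k ≡ i' → OccursAt A (suc k) x →
                  Corners x (suc i) (suc i') (suc j) (suc j')
  upper-corners (_ , _ , (_ , eij) , (_ , eij') , (_ , ei'j) , _) k∈rows =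
    edge-square eij eij' ei'j (Sum.map (cong suc) (cong suc) k∈rows)

  same-corners : ∀ {x i i' j j' k k' l l'} → TwoMaxDuo A B →
                 i ≢ i' → j ≢ j' → k ≢ k' → l ≢ l' →
                 Corners x i i' j j' → Corners x k k' l l' →
                 SamePair k k' i i' × SamePair l l' j j'
  same-corners {x} duo i≢i' j≢j' k≢k' l≢l' (Ai , Ai' , Bj , Bj') (Ak , Ak' , Bl , Bl') =
    same-positions A (TwoMaxDuo.atMost2A duo x) i≢i' k≢k' Ai Ai' Ak Ak' ,
    same-positions B (TwoMaxDuo.atMost2B duo x) j≢j' l≢l' Bj Bj' Bl Bl'

lemma2p7 : {n : ℕ} (A B : Vec ℕ n) → TwoMaxDuo A B →
    (i j i₁ i₁' j₁ j₁' i₂ i₂' j₂ j₂' : ℕ) →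
    Vertex A B i j → Vertex A B (suc i) (suc j) →
    IsSquare A B i₁ i₁' j₁ j₁' → IsSquare A B i₂ i₂' j₂ j₂' →
    ¬ SameSquare i₁ i₁' j₁ j₁' i₂ i₂' j₂ j₂' →
    InSquare i j i₁ i₁' j₁ j₁' → InSquare (suc i) (suc j) i₂ i₂' j₂ j₂' →
    SamePair i₂ i₂' (suc i₁) (suc i₁') × SamePair j₂ j₂' (suc j₁) (suc j₁')
lemma2p7 A B duo i j i₁ i₁' j₁ j₁' i₂ i₂' j₂ j₂' _ ((i+1< , _) , _)
         sq₁@(i₁≢i₁' , j₁≢j₁' , _) sq₂@(i₂≢i₂' , j₂≢j₂' , _) _ (i∈row₁ , _) (i+1∈row₂ , _) =
  same-corners A B duo (i₁≢i₁' ∘ suc-injective) (j₁≢j₁' ∘ suc-injective) i₂≢i₂' j₂≢j₂'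
    (upper-corners A B sq₁ i∈row₁ letter) (lower-corners A B sq₂ i+1∈row₂ letter)
  where
  letter : OccursAt A (suc i) (lookup A (fromℕ< i+1<))
  letter = i+1< , refl
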